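{- Let $H$ be a cubic Halin graph and let $v$ be a peripheral vertex of $H$. Then $H$ is totally $4$-colorable if and only if the palette $P(T^H_v)$ contains a completable extendable precoloring.
   Context: A Halin graph is obtained from a plane embedding of a tree $T$ with at least three leaves and no vertices of degree two by adding a cycle through all leaves without crossings. Vertices of $H$ corresponding to leaves of $T$ are peripheral; edges joining two peripheral vertices are peripheral edges, all other edges are spanning edges. A total coloring assigns colors to vertices and edges so that adjacent or incident elements get distinct colors. For a peripheral vertex $v$ of $H$, $T^H_v$ is the tripole obtained from $H$ by deleting $v$ but keeping its three incident edges as semi-edges (each incident with only one vertex); the root semi-edge $r$ is the one corresponding to the spanning edge at $v$, and $x,y$ are the other two semi-edges (the two peripheral edges at $v$), taken in the order given by the plane embedding. Letting $r^*,x^*,y^*$ be the vertices of the tripole incident with $r,x,y$, the extended boundary is $(r,r^*,x,x^*,y,y^*)$. A total 4-coloring $\varphi$ of the tripole (semi-edges included, colors $\{0,1,2,3\}$) induces the sextuple $(\varphi(r),\varphi(r^*),\varphi(x),\varphi(x^*),\varphi(y),\varphi(y^*))$; the set of all sextuples arising this way (the extendable precolorings) is the palette $P(T^H_v)$. A sextuple $s=(a,b,c,d,e,f)$ with $a\ne b$, $c\ne d$, $e\ne f$ is completable if $|\{a,c,e\}|=3$ and $|\{a,b,c,d,e,f\}|=3$. -}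

module Defs where

open import Data.Nat using (ℕ; zero; suc; _+_)
open import Data.Fin using (Fin; zero; suc; _≟_)
open import Data.Fin.Base using (toℕ)
open import Data.Maybe using (Maybe; just; nothing; maybe)
open import Data.List using (List; []; _∷_; length; filter; catMaybes)
open import Data.List.Base using (allFin)
open import Data.List.Membership.Propositional using (_∈_)
open import Data.List.Membership.DecPropositional (_≟_ {4}) using (_∈?_)
open import Data.Vec using (Vec; []; _∷_; _++_; map)
open import Data.Sum using (_⊎_; inj₁; inj₂)
open import Data.Product using (_×_; _,_; proj₁; proj₂; Σ; ∃)
open import Relation.Binary.PropositionalEquality using (_≡_; _≢_)

-- Graphs with (possibly) semi-edges.
-- Every edge e has a list of incident vertices `ends e`:
-- a (full) edge has two ends, a semi-edge has one.

record Graph : Set₁ where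
  field
    V    : Set
    E    : Set
    ends : E → List V

open Graph public

record TotalColoring (k : ℕ) (G : Graph) : Set where
  field
    vcol : V G → Fin k
    ecol : E G → Fin k
    adjV : ∀ e u w → ends G e ≡ u ∷ w ∷ [] → vcol u ≢ vcol w
    incVE : ∀ e u → u ∈ ends G e → ecol e ≢ vcol u
    adjE : ∀ e e′ u → e ≢ e′ → u ∈ ends G e → u ∈ ends G e′ → ecol e ≢ ecol e′

open TotalColoring public

TotallyColorable : ℕ → Graph → Set
TotallyColorable k G = TotalColoring k G

-- Rooting a plane tree with no degree-2 vertices, all internal degrees 3,
-- at its leaf v gives a full binary tree `t` (the subtree hanging from the
-- neighbour r* of v); left/right children follow the plane embedding.
-- T has at least three leaves iff t is a `node`.

data Bin : Set where
  leaf : Bin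
  node : Bin → Bin → Bin

data Pos : Bin → Set where
  here : ∀ {t} → Pos t
  goL  : ∀ {l r} → Pos l → Pos (node l r)
  goR  : ∀ {l r} → Pos r → Pos (node l r)

-- parent of a position; the root's parent is the leaf v (= nothing)
parentOf : ∀ {t} → Pos t → Maybe (Pos t)
parentOf here    = nothing
parentOf (goL p) = just (maybe goL here (parentOf p))
parentOf (goR p) = just (maybe goR here (parentOf p))

nleaves : Bin → ℕ
nleaves leaf       = 1
nleaves (node l r) = nleaves l + nleaves r

leaves : (t : Bin) → Vec (Pos t) (nleaves t)
leaves leaf       = here ∷ []
leaves (node l r) = map goL (leaves l) ++ map goR (leaves r)

cycPairs : ∀ {A : Set} {n} → A → Vec A (suc n) → Fin (suc n) → A × A
cycPairs a₀ (x ∷ [])     zero    = x , a₀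
cycPairs a₀ (x ∷ y ∷ ys) zero    = x , y
cycPairs a₀ (x ∷ y ∷ ys) (suc i) = cycPairs a₀ (y ∷ ys) i

-- the peripheral cycle: v, then the leaves of t in plane order
cycle : (t : Bin) → Vec (Maybe (Pos t)) (suc (nleaves t))
cycle t = nothing ∷ map just (leaves t)

-- edges of H: spanning edges (one per position: to its parent) and
-- peripheral edges (edge i joins cycle[i] and cycle[i+1 mod]).
HEdge : Bin → Set
HEdge t = Pos t ⊎ Fin (suc (nleaves t))

HEnds : (t : Bin) → HEdge t → List (Maybe (Pos t))
HEnds t (inj₁ p) = just p ∷ parentOf p ∷ []
HEnds t (inj₂ i) = proj₁ (cycPairs nothing (cycle t) i) ∷ proj₂ (cycPairs nothing (cycle t) i) ∷ []

Halin : Bin → Graph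
Halin t = record { V = Maybe (Pos t) ; E = HEdge t ; ends = HEnds t }

-- The tripole T^H_v: delete v, keeping its incident edges as semi-edges.
Tripole : Bin → Graph
Tripole t = record { V = Pos t ; E = HEdge t ; ends = λ e → catMaybes (HEnds t e) }

-- root semi-edge r (spanning edge at v), x (peripheral edge v–first leaf),
-- y (peripheral edge last leaf–v)
rEdge xEdge yEdge : (t : Bin) → HEdge t
rEdge t = inj₁ here
xEdge t = inj₂ zero
yEdge t = inj₂ (Data.Fin.fromℕ (nleaves t))

firstLeaf lastLeaf : (t : Bin) → Pos t
firstLeaf leaf       = here
firstLeaf (node l r) = goL (firstLeaf l)
lastLeaf leaf        = here
lastLeaf (node l r)  = goR (lastLeaf r)

rStar xStar yStar : (t : Bin) → Pos t
rStar t = here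
xStar t = firstLeaf t
yStar t = lastLeaf t

Sextuple : Set
Sextuple = Vec (Fin 4) 6

induced : (t : Bin) → TotalColoring 4 (Tripole t) → Sextuple
induced t φ = ecol φ (rEdge t) ∷ vcol φ (rStar t)
            ∷ ecol φ (xEdge t) ∷ vcol φ (xStar t)
            ∷ ecol φ (yEdge t) ∷ vcol φ (yStar t) ∷ []

Palette : (t : Bin) → Sextuple → Set
Palette t s = Σ (TotalColoring 4 (Tripole t)) (λ φ → induced t φ ≡ s)

numColors : List (Fin 4) → ℕ
numColors xs = length (filter (_∈? xs) (allFin 4))

Completable : Sextuple → Set
Completable (a ∷ b ∷ c ∷ d ∷ e ∷ f ∷ []) =
  (a ≢ b) × (c ≢ d) × (e ≢ f)
  × (numColors (a ∷ c ∷ e ∷ []) ≡ 3)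
  × (numColors (a ∷ b ∷ c ∷ d ∷ e ∷ f ∷ []) ≡ 3)

{-# OPTIONS --safe #-}
-- The only vertex of H outside the tripole is v, whose three edges r, x, y
-- are the semi-edges of the tripole. A total 4-colouring of H therefore
-- restricts to one of the tripole, and a total 4-colouring of the tripole
-- extends to H exactly when some colour m can be given to v: the colours of
-- r, x, y must be pairwise distinct (they meet at v) and m must avoid all six
-- colours of the extended boundary. For a proper boundary this is precisely
-- completability: with the colours of r, x, y distinct, the six colours take
-- exactly three values iff one of the four colours is missing.
module Submission where

open import Defs
open import Data.Fin using (Fin; zero; suc; _≟_; fromℕ)
open import Data.Fin.Properties using (all?; any?)
open import Data.List using (List; []; _∷_; catMaybes)
open import Data.List.Membership.Propositional using (_∈_)
open import Data.List.Relation.Unary.Any using (here; there)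
open import Data.Maybe using (Maybe; just; nothing; maybe′)
import Data.Nat as ℕ
open import Data.Product using (Σ; ∃; _×_; _,_; proj₁; proj₂; uncurry)
open import Data.Sum using (_⊎_; inj₁; inj₂; [_,_]′)
open import Data.Sum.Properties using (inj₂-injective)
open import Data.Vec using (Vec; []; _∷_; map; _++_; lookup)
open import Data.Vec.Properties using (lookup-map)
import Data.Vec.Relation.Unary.All as All
open All using (All; []; _∷_)
open import Function using (_∘_)
open import Function.Bundles using (_⇔_; mk⇔; Equivalence)
open import Relation.Nullary using (Dec; ¬?; contradiction)
open import Relation.Nullary.Decidable using (toWitness; map′; _×-dec_; _→-dec_)
open import Relation.Binary.PropositionalEquality
  using (_≡_; _≢_; refl; sym; trans; cong; subst; ≢-sym; module ≡-Reasoning)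

Distinct₃ : Fin 4 → Fin 4 → Fin 4 → Set
Distinct₃ a c e = a ≢ c × a ≢ e × c ≢ e

-- Giving v the colour m completes the precolouring s of the tripole.
Completion : Sextuple → Fin 4 → Set
Completion s@(a ∷ _ ∷ c ∷ _ ∷ e ∷ _ ∷ []) m = Distinct₃ a c e × All (m ≢_) s

completion? : ∀ s m → Dec (Completion s m)
completion? s@(a ∷ _ ∷ c ∷ _ ∷ e ∷ _ ∷ []) m =
  (¬? (a ≟ c) ×-dec ¬? (a ≟ e) ×-dec ¬? (c ≟ e)) ×-dec All.all? (λ x → ¬? (m ≟ x)) s

_⇔-dec_ : ∀ {A B : Set} → Dec A → Dec B → Dec (A ⇔ B)
a? ⇔-dec b? = map′ (uncurry mk⇔) (λ a⇔b → Equivalence.to a⇔b , Equivalence.from a⇔b)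
                   ((a? →-dec b?) ×-dec (b? →-dec a?))

numColors≡3⇔completion : ∀ a b c d e f →
  (numColors (a ∷ c ∷ e ∷ []) ≡ 3 × numColors (a ∷ b ∷ c ∷ d ∷ e ∷ f ∷ []) ≡ 3)
    ⇔ ∃ (Completion (a ∷ b ∷ c ∷ d ∷ e ∷ f ∷ []))
numColors≡3⇔completion = toWitness
  {a? = all? λ a → all? λ b → all? λ c → all? λ d → all? λ e → all? λ f →
          (numColors (a ∷ c ∷ e ∷ []) ℕ.≟ 3 ×-dec numColors (a ∷ b ∷ c ∷ d ∷ e ∷ f ∷ []) ℕ.≟ 3)
            ⇔-dec any? (completion? (a ∷ b ∷ c ∷ d ∷ e ∷ f ∷ []))}
  _

module _ {A : Set} where

  ∈-catMaybes⁺ : ∀ {x : A} xs → just x ∈ xs → x ∈ catMaybes xs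
  ∈-catMaybes⁺ (just _ ∷ _)   (here refl) = here refl
  ∈-catMaybes⁺ (just _ ∷ xs)  (there x∈) = there (∈-catMaybes⁺ xs x∈)
  ∈-catMaybes⁺ (nothing ∷ xs) (there x∈) = ∈-catMaybes⁺ xs x∈

  ∈-catMaybes⁻ : ∀ {x : A} xs → x ∈ catMaybes xs → just x ∈ xs
  ∈-catMaybes⁻ (just _ ∷ _)   (here refl) = here refl
  ∈-catMaybes⁻ (just _ ∷ xs)  (there x∈) = there (∈-catMaybes⁻ xs x∈)
  ∈-catMaybes⁻ (nothing ∷ xs) x∈         = there (∈-catMaybes⁻ xs x∈)

  catMaybes-pair : ∀ {p q : Maybe A} {u w} →
    catMaybes (p ∷ q ∷ []) ≡ u ∷ w ∷ [] → (p , q) ≡ (just u , just w)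
  catMaybes-pair {just _}  {just _}  refl = refl
  catMaybes-pair {just _}  {nothing} ()
  catMaybes-pair {nothing} {just _}  ()
  catMaybes-pair {nothing} {nothing} ()

data _IsHeadOf_ {A : Set} (z : A) : ∀ {n} → Vec A n → Set where
  head : ∀ {n} (xs : Vec A n) → z IsHeadOf (z ∷ xs)

data _IsLastOf_ {A : Set} (z : A) : ∀ {n} → Vec A n → Set where
  last : z IsLastOf (z ∷ [])
  _∷_  : ∀ {n} x {xs : Vec A n} → z IsLastOf xs → z IsLastOf (x ∷ xs)

module _ {A : Set} {z : A} where

  IsHeadOf-map : ∀ {B : Set} (f : A → B) {n} {xs : Vec A n} → z IsHeadOf xs → f z IsHeadOf map f xs
  IsHeadOf-map f (head xs) = head (map f xs)

  IsHeadOf-++ : ∀ {m n} {xs : Vec A m} (ys : Vec A n) → z IsHeadOf xs → z IsHeadOf (xs ++ ys)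
  IsHeadOf-++ ys (head xs) = head (xs ++ ys)

  IsLastOf-map : ∀ {B : Set} (f : A → B) {n} {xs : Vec A n} → z IsLastOf xs → f z IsLastOf map f xs
  IsLastOf-map f last       = last
  IsLastOf-map f (x ∷ z∈xs) = f x ∷ IsLastOf-map f z∈xs

  IsLastOf-++ : ∀ {m n} (xs : Vec A m) {ys : Vec A n} → z IsLastOf ys → z IsLastOf (xs ++ ys)
  IsLastOf-++ []       z∈ys = z∈ys
  IsLastOf-++ (x ∷ xs) z∈ys = x ∷ IsLastOf-++ xs z∈ys

  zero≢fromℕ : ∀ {n} {xs : Vec A n} → z IsHeadOf xs → zero ≢ fromℕ n
  zero≢fromℕ (head _) ()

module _ {A : Set} {a₀ : A} where

  cycPairs-head : ∀ {w z n} {xs : Vec A n} → z IsHeadOf xs →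
    cycPairs a₀ (w ∷ xs) zero ≡ (w , z)
  cycPairs-head (head _) = refl

  cycPairs-last : ∀ {w z n} {xs : Vec A n} → z IsLastOf xs →
    cycPairs a₀ (w ∷ xs) (fromℕ n) ≡ (z , a₀)
  cycPairs-last last       = refl
  cycPairs-last (_ ∷ z∈xs) = cycPairs-last z∈xs

  cycPairs-fst≡lookup : ∀ {n} (xs : Vec A (ℕ.suc n)) i → proj₁ (cycPairs a₀ xs i) ≡ lookup xs i
  cycPairs-fst≡lookup (x ∷ [])     zero    = refl
  cycPairs-fst≡lookup (x ∷ y ∷ ys) zero    = refl
  cycPairs-fst≡lookup (x ∷ y ∷ ys) (suc i) = cycPairs-fst≡lookup (y ∷ ys) i

module _ {A : Set} where

  cycPairs-fst≡nothing : ∀ {n} (xs : Vec A n) i →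
    proj₁ (cycPairs nothing (nothing ∷ map just xs) i) ≡ nothing → i ≡ zero
  cycPairs-fst≡nothing xs zero    _  = refl
  cycPairs-fst≡nothing xs (suc i) eq = contradiction just≡nothing λ ()
    where
    open ≡-Reasoning
    just≡nothing : just (lookup xs i) ≡ nothing
    just≡nothing = begin
      just (lookup xs i)                                       ≡⟨ lookup-map i just xs ⟨
      lookup (map just xs) i                                   ≡⟨ cycPairs-fst≡lookup (nothing ∷ map just xs) (suc i) ⟨
      proj₁ (cycPairs nothing (nothing ∷ map just xs) (suc i)) ≡⟨ eq ⟩
      nothing                                                  ∎

  cycPairs-snd≡nothing : ∀ {n} (xs : Vec A n) w i →
    proj₂ (cycPairs nothing (w ∷ map just xs) i) ≡ nothing → i ≡ fromℕ n
  cycPairs-snd≡nothing []       w zero    _  = refl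
  cycPairs-snd≡nothing (x ∷ xs) w (suc i) eq = cong suc (cycPairs-snd≡nothing xs (just x) i eq)

firstLeaf-head : ∀ t → firstLeaf t IsHeadOf leaves t
firstLeaf-head leaf       = head []
firstLeaf-head (node l r) = IsHeadOf-++ (map goR (leaves r)) (IsHeadOf-map goL (firstLeaf-head l))

lastLeaf-last : ∀ t → lastLeaf t IsLastOf leaves t
lastLeaf-last leaf       = last
lastLeaf-last (node l r) = IsLastOf-++ (map goL (leaves l)) (IsLastOf-map goR (lastLeaf-last r))

pairToList : ∀ {A : Set} → A × A → List A
pairToList (a , b) = a ∷ b ∷ []

xEdge-ends : ∀ t → HEnds t (xEdge t) ≡ nothing ∷ just (xStar t) ∷ []
xEdge-ends t = cong pairToList (cycPairs-head (IsHeadOf-map just (firstLeaf-head t)))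

yEdge-ends : ∀ t → HEnds t (yEdge t) ≡ just (yStar t) ∷ nothing ∷ []
yEdge-ends t = cong pairToList (cycPairs-last (IsLastOf-map just (lastLeaf-last t)))

xEdge≢yEdge : ∀ t → xEdge t ≢ yEdge t
xEdge≢yEdge t = zero≢fromℕ (firstLeaf-head t) ∘ inj₂-injective

parentOf≡nothing : ∀ {t} (p : Pos t) → parentOf p ≡ nothing → p ≡ here
parentOf≡nothing here _ = refl

data SemiEdge (t : Bin) : HEdge t → Pos t → Set where
  r-semi : SemiEdge t (rEdge t) (rStar t)
  x-semi : SemiEdge t (xEdge t) (xStar t)
  y-semi : SemiEdge t (yEdge t) (yStar t)

module _ {t : Bin} where

  semiEdge-ends : ∀ {e w} → SemiEdge t e w →
    HEnds t e ≡ just w ∷ nothing ∷ [] ⊎ HEnds t e ≡ nothing ∷ just w ∷ []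
  semiEdge-ends r-semi = inj₁ refl
  semiEdge-ends x-semi = inj₂ (xEdge-ends t)
  semiEdge-ends y-semi = inj₁ (yEdge-ends t)

  semiEdge-∋v : ∀ {e w} → SemiEdge t e w → nothing ∈ HEnds t e
  semiEdge-∋v s = [ (λ eq → subst (nothing ∈_) (sym eq) (there (here refl)))
                  , (λ eq → subst (nothing ∈_) (sym eq) (here refl)) ]′ (semiEdge-ends s)

  semiEdge-tripoleEnds : ∀ {e w} → SemiEdge t e w → ends (Tripole t) e ≡ w ∷ []
  semiEdge-tripoleEnds s = [ cong catMaybes , cong catMaybes ]′ (semiEdge-ends s)

  ∋v⇒semiEdge : ∀ e → nothing ∈ HEnds t e → ∃ (SemiEdge t e)
  ∋v⇒semiEdge (inj₁ p) (there (here v≡parent))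
    with refl ← parentOf≡nothing p (sym v≡parent) = _ , r-semi
  ∋v⇒semiEdge (inj₂ i) (here v≡fst)
    with refl ← cycPairs-fst≡nothing (leaves t) i (sym v≡fst) = _ , x-semi
  ∋v⇒semiEdge (inj₂ i) (there (here v≡snd))
    with refl ← cycPairs-snd≡nothing (leaves t) nothing i (sym v≡snd) = _ , y-semi

  fullEdge-HEnds : ∀ e {u w} → ends (Tripole t) e ≡ u ∷ w ∷ [] → HEnds t e ≡ just u ∷ just w ∷ []
  fullEdge-HEnds (inj₁ _) = cong pairToList ∘ catMaybes-pair
  fullEdge-HEnds (inj₂ _) = cong pairToList ∘ catMaybes-pair

  restrict : TotalColoring 4 (Halin t) → TotalColoring 4 (Tripole t)
  restrict ψ = record
    { vcol  = vcol ψ ∘ just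
    ; ecol  = ecol ψ
    ; adjV  = λ e u w eq → adjV ψ e (just u) (just w) (fullEdge-HEnds e eq)
    ; incVE = λ e u u∈e → incVE ψ e (just u) (∈-catMaybes⁻ (HEnds t e) u∈e)
    ; adjE  = λ e e′ u e≢e′ u∈e u∈e′ →
        adjE ψ e e′ (just u) e≢e′ (∈-catMaybes⁻ (HEnds t e) u∈e) (∈-catMaybes⁻ (HEnds t e′) u∈e′)
    }

  semiEdge-proper : (φ : TotalColoring 4 (Tripole t)) →
    ∀ {e w} → SemiEdge t e w → ecol φ e ≢ vcol φ w
  semiEdge-proper φ {e} {w} s =
    incVE φ e w (subst (w ∈_) (sym (semiEdge-tripoleEnds s)) (here refl))

  restrict-completion : (ψ : TotalColoring 4 (Halin t)) →
    Completion (induced t (restrict ψ)) (vcol ψ nothing)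
  restrict-completion ψ =
    (distinct r-semi x-semi (λ ()) , distinct r-semi y-semi (λ ())
      , distinct x-semi y-semi (xEdge≢yEdge t)) ,
    proj₁ (fresh r-semi) ∷ proj₂ (fresh r-semi) ∷ proj₁ (fresh x-semi) ∷ proj₂ (fresh x-semi)
      ∷ proj₁ (fresh y-semi) ∷ proj₂ (fresh y-semi) ∷ []
    where
    distinct : ∀ {e e′ w w′} → SemiEdge t e w → SemiEdge t e′ w′ → e ≢ e′ → ecol ψ e ≢ ecol ψ e′
    distinct {e} {e′} s s′ e≢e′ = adjE ψ e e′ nothing e≢e′ (semiEdge-∋v s) (semiEdge-∋v s′)

    fresh : ∀ {e w} → SemiEdge t e w → vcol ψ nothing ≢ ecol ψ e × vcol ψ nothing ≢ vcol ψ (just w)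
    fresh {e} {w} s =
      ≢-sym (incVE ψ e nothing (semiEdge-∋v s)) ,
      [ ≢-sym ∘ adjV ψ e (just w) nothing , adjV ψ e nothing (just w) ]′ (semiEdge-ends s)

  module _ (φ : TotalColoring 4 (Tripole t)) {m : Fin 4} where

    completion-fresh : Completion (induced t φ) m →
      ∀ {e w} → SemiEdge t e w → m ≢ ecol φ e × m ≢ vcol φ w
    completion-fresh (_ , m≢a ∷ m≢b ∷ _)                     r-semi = m≢a , m≢b
    completion-fresh (_ , _ ∷ _ ∷ m≢c ∷ m≢d ∷ _)             x-semi = m≢c , m≢d
    completion-fresh (_ , _ ∷ _ ∷ _ ∷ _ ∷ m≢e ∷ m≢f ∷ [])    y-semi = m≢e , m≢f

    completion-distinct : Completion (induced t φ) m →
      ∀ {e e′ w w′} → SemiEdge t e w → SemiEdge t e′ w′ → e ≢ e′ → ecol φ e ≢ ecol φ e′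
    completion-distinct _                     r-semi r-semi e≢e′ = contradiction refl e≢e′
    completion-distinct ((a≢c , _ , _) , _)   r-semi x-semi _    = a≢c
    completion-distinct ((_ , a≢e , _) , _)   r-semi y-semi _    = a≢e
    completion-distinct ((a≢c , _ , _) , _)   x-semi r-semi _    = ≢-sym a≢c
    completion-distinct _                     x-semi x-semi e≢e′ = contradiction refl e≢e′
    completion-distinct ((_ , _ , c≢e) , _)   x-semi y-semi _    = c≢e
    completion-distinct ((_ , a≢e , _) , _)   y-semi r-semi _    = ≢-sym a≢e
    completion-distinct ((_ , _ , c≢e) , _)   y-semi x-semi _    = ≢-sym c≢e
    completion-distinct _                     y-semi y-semi e≢e′ = contradiction refl e≢e′

    extend : Completion (induced t φ) m → TotalColoring 4 (Halin t)
    extend completion = record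
      { vcol = colour ; ecol = ecol φ ; adjV = adjacent ; incVE = incident ; adjE = adjacentEdges }
      where
      colour : Maybe (Pos t) → Fin 4
      colour = maybe′ (vcol φ) m

      v-adjacent : ∀ {e u} → nothing ∈ HEnds t e →
        ends (Tripole t) e ≡ catMaybes (u ∷ []) → m ≢ colour u
      v-adjacent {e} {u} v∈e e-ends with w , s ← ∋v⇒semiEdge e v∈e
        with u | trans (sym e-ends) (semiEdge-tripoleEnds s)
      ... | just _ | refl = proj₂ (completion-fresh completion s)

      adjacent : ∀ e u u′ → HEnds t e ≡ u ∷ u′ ∷ [] → colour u ≢ colour u′
      adjacent e (just p) (just q) eq = adjV φ e p q (cong catMaybes eq)
      adjacent e nothing  u′       eq =
        v-adjacent {u = u′} (subst (nothing ∈_) (sym eq) (here refl)) (cong catMaybes eq)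
      adjacent e u        nothing  eq =
        ≢-sym (v-adjacent {u = u} (subst (nothing ∈_) (sym eq) (there (here refl)))
                              (cong catMaybes eq))

      incident : ∀ e u → u ∈ HEnds t e → ecol φ e ≢ colour u
      incident e (just p) p∈e = incVE φ e p (∈-catMaybes⁺ (HEnds t e) p∈e)
      incident e nothing  v∈e =
        ≢-sym (proj₁ (completion-fresh completion (proj₂ (∋v⇒semiEdge e v∈e))))

      adjacentEdges : ∀ e e′ u → e ≢ e′ → u ∈ HEnds t e → u ∈ HEnds t e′ → ecol φ e ≢ ecol φ e′
      adjacentEdges e e′ (just p) e≢e′ p∈e p∈e′ =
        adjE φ e e′ p e≢e′ (∈-catMaybes⁺ (HEnds t e) p∈e) (∈-catMaybes⁺ (HEnds t e′) p∈e′)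
      adjacentEdges e e′ nothing e≢e′ v∈e v∈e′ =
        completion-distinct completion
          (proj₂ (∋v⇒semiEdge e v∈e)) (proj₂ (∋v⇒semiEdge e′ v∈e′)) e≢e′

colourable⇒completable : ∀ t → TotallyColorable 4 (Halin t) →
  Σ Sextuple (λ s → Palette t s × Completable s)
colourable⇒completable t ψ =
  induced t φ , (φ , refl) ,
  semiEdge-proper φ r-semi , semiEdge-proper φ x-semi , semiEdge-proper φ y-semi ,
  Equivalence.from (numColors≡3⇔completion _ _ _ _ _ _) (vcol ψ nothing , restrict-completion ψ)
  where
  φ : TotalColoring 4 (Tripole t)
  φ = restrict ψ

completable⇒colourable : ∀ t → Σ Sextuple (λ s → Palette t s × Completable s) →
  TotallyColorable 4 (Halin t)
completable⇒colourable t (_ , (φ , refl) , _ , _ , _ , numColors≡3) =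
  extend φ (proj₂ (Equivalence.to (numColors≡3⇔completion _ _ _ _ _ _) numColors≡3))

lemma1 : (l r : Bin) →
    TotallyColorable 4 (Halin (node l r))
      ⇔ Σ Sextuple (λ s → Palette (node l r) s × Completable s)
lemma1 l r = mk⇔ (colourable⇒completable (node l r)) (completable⇒colourable (node l r))
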